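{- Let $\mathcal{F}=(W,\preccurlyeq,V_{\mathcal{F}})$ be a finite poset model and $w_1,w_2\in W$. If $w_1\rightleftharpoons w_2$, then $w_1\equiv_\eta w_2$.
   Context: $\mathcal{F}$: finite partial order $(W,\preccurlyeq)$ with $V_{\mathcal{F}}:PL\to2^W$; $V^{ -1}(w)=\{p:w\in V_{\mathcal{F}}(p)\}$. An undirected path of length $\ell$ is $\pi:\{0,\dots,\ell\}\to W$ with $\pi(i)\preccurlyeq\pi(i+1)$ or $\pi(i+1)\preccurlyeq\pi(i)$ for all $i<\ell$; a $\pm$-path is an undirected path with $\ell\ge2$, $\pi(0)\preccurlyeq\pi(1)$ and $\pi(\ell)\preccurlyeq\pi(\ell-1)$. $w_1\rightleftharpoons w_2$ iff there is an undirected path $\pi$ of some length $\ell$ with $\pi(0)=w_1$, $\pi(\ell)=w_2$, and $V^{ -1}(\pi(i))=V^{ -1}(\pi(j))$ for all $i,j$. $\mathrm{SLCS}_\eta$: $\Phi::=p\mid\neg\Phi\mid\Phi_1\wedge\Phi_2\mid\eta(\Phi_1,\Phi_2)$; $w\models p$ iff $w\in V_{\mathcal{F}}(p)$, Boolean connectives standard, $w\models\eta(\Phi_1,\Phi_2)$ iff some $\pm$-path $\pi$ of length $\ell$ with $\pi(0)=w$ has $\pi(\ell)\models\Phi_2$ and $\pi(i)\models\Phi_1$ for all $i<\ell$; $\equiv_\eta$: satisfying the same formulas. -}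

module Defs where

open import Data.Nat using (ℕ; zero; suc; _≤_; _<_)
open import Data.Fin using (Fin)
open import Data.Bool using (Bool; true)
open import Data.Product using (_×_; Σ-syntax; ∃-syntax)
open import Data.Sum using (_⊎_)
open import Relation.Nullary using (¬_)
open import Relation.Binary.PropositionalEquality using (_≡_)
open import Relation.Binary.Structures using (IsPartialOrder)

-- A finite poset model over a set PL of proposition letters:
-- worlds are Fin n (an arbitrary finite set, up to renaming),
-- _≼_ is a partial order, and (V p w ≡ true) means w ∈ V_F(p).
record PosetModel (PL : Set) : Set₁ where
  field
    n     : ℕ
    _≼_   : Fin n → Fin n → Set
    isPO  : IsPartialOrder _≡_ _≼_
    V     : PL → Fin n → Bool

data Formula (PL : Set) : Set where
  prop : PL → Formula PL
  ¬F_  : Formula PL → Formula PL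
  _∧F_ : Formula PL → Formula PL → Formula PL
  η    : Formula PL → Formula PL → Formula PL

module _ {PL : Set} (F : PosetModel PL) where
  open PosetModel F

  World : Set
  World = Fin n

  -- A path π : {0,…,ℓ} → W is represented by a function ℕ → W;
  -- only its values at 0,…,ℓ matter in all conditions below.
  IsUPath : ℕ → (ℕ → World) → Set
  IsUPath ℓ π = ∀ i → i < ℓ → (π i ≼ π (suc i)) ⊎ (π (suc i) ≼ π i)

  IsPMPath : ℕ → (ℕ → World) → Set
  IsPMPath ℓ π = IsUPath ℓ π × (2 ≤ ℓ) × (π 0 ≼ π 1)
                 × (∀ k → suc k ≡ ℓ → π ℓ ≼ π k)

  SameLabel : World → World → Set
  SameLabel w w' = ∀ p → V p w ≡ V p w'

  _⇌_ : World → World → Set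
  w₁ ⇌ w₂ = Σ[ ℓ ∈ ℕ ] Σ[ π ∈ (ℕ → World) ]
              IsUPath ℓ π × (π 0 ≡ w₁) × (π ℓ ≡ w₂)
              × (∀ i j → i ≤ ℓ → j ≤ ℓ → SameLabel (π i) (π j))

  _⊨_ : World → Formula PL → Set
  w ⊨ prop p   = V p w ≡ true
  w ⊨ (¬F φ)   = ¬ (w ⊨ φ)
  w ⊨ (φ ∧F ψ) = (w ⊨ φ) × (w ⊨ ψ)
  w ⊨ η φ ψ    = Σ[ ℓ ∈ ℕ ] Σ[ π ∈ (ℕ → World) ]
                   IsPMPath ℓ π × (π 0 ≡ w) × (π ℓ ⊨ ψ)
                   × (∀ i → i < ℓ → π i ⊨ φ)

  _≡η_ : World → World → Set
  w₁ ≡η w₂ = ∀ (φ : Formula PL) → ((w₁ ⊨ φ) → (w₂ ⊨ φ)) × ((w₂ ⊨ φ) → (w₁ ⊨ φ))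

module Submission where

open import Defs
open import Data.Nat using (ℕ; zero; suc; _≤_; _<_; z≤n; s≤s)
open import Data.Nat.Properties using (≤-refl; <⇒≤)
open import Data.Product using (_,_)
open import Data.Sum using (_⊎_; inj₁; inj₂)
open import Function using (id; _∘_)
open import Relation.Binary.PropositionalEquality using (_≡_; refl; sym; trans)
open import Relation.Binary.Structures using (IsPartialOrder)

-- Transporting a formula along one step of an undirected path is straightforward except for η:
-- a ±-path from one end of the step is turned into a ±-path from the other end by prepending
-- the new start twice, the repetition supplying the required initial ≼-step by reflexivity.
-- Since ¬ forces the transport in both directions, the induction proves ≡η for adjacent,
-- equally labelled worlds, and transitivity of ≡η extends it along the whole path.

module _ {PL : Set} (F : PosetModel PL) where
  open PosetModel F

  Adjacent : World F → World F → Set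
  Adjacent a b = (a ≼ b) ⊎ (b ≼ a)

  Adjacent-sym : ∀ {a b} → Adjacent a b → Adjacent b a
  Adjacent-sym (inj₁ a≼b) = inj₂ a≼b
  Adjacent-sym (inj₂ b≼a) = inj₁ b≼a

  SameLabel-sym : ∀ {a b} → SameLabel F a b → SameLabel F b a
  SameLabel-sym a~b p = sym (a~b p)

  ≡η-refl : ∀ {a} → _≡η_ F a a
  ≡η-refl φ = id , id

  ≡η-trans : ∀ {a b c} → _≡η_ F a b → _≡η_ F b c → _≡η_ F a c
  ≡η-trans a≡b b≡c φ with a≡b φ | b≡c φ
  ... | a⇒b , b⇒a | b⇒c , c⇒b = b⇒c ∘ a⇒b , b⇒a ∘ c⇒b

  _◃_ : World F → (ℕ → World F) → ℕ → World F
  (b ◃ π) zero    = b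
  (b ◃ π) (suc i) = π i

  ◃◃-IsPMPath : ∀ {b ℓ π} → Adjacent b (π 0) → IsPMPath F ℓ π →
                IsPMPath F (suc (suc ℓ)) (b ◃ (b ◃ π))
  ◃◃-IsPMPath {b} {ℓ} {π} b~π₀ (path , s≤s (s≤s z≤n) , _ , end) =
    path′ , s≤s (s≤s z≤n) , ≼-refl , end′
    where
    ≼-refl : b ≼ b
    ≼-refl = IsPartialOrder.refl isPO
    path′ : IsUPath F (suc (suc ℓ)) (b ◃ (b ◃ π))
    path′ zero          _               = inj₁ ≼-refl
    path′ (suc zero)    _               = b~π₀
    path′ (suc (suc i)) (s≤s (s≤s i<ℓ)) = path i i<ℓ
    end′ : ∀ k → suc k ≡ suc (suc ℓ) → π ℓ ≼ (b ◃ (b ◃ π)) k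
    end′ (suc (suc k)) refl = end k refl

  ⊨-step : ∀ φ {a b} → Adjacent a b → SameLabel F a b → _⊨_ F a φ → _⊨_ F b φ
  ⊨-step (prop p) a~b same a⊨p = trans (sym (same p)) a⊨p
  ⊨-step (¬F φ) a~b same a⊭φ b⊨φ =
    a⊭φ (⊨-step φ (Adjacent-sym a~b) (SameLabel-sym same) b⊨φ)
  ⊨-step (φ ∧F ψ) a~b same (a⊨φ , a⊨ψ) = ⊨-step φ a~b same a⊨φ , ⊨-step ψ a~b same a⊨ψ
  ⊨-step (η φ ψ) {b = b} a~b same (ℓ , π , pm@(_ , s≤s _ , _) , refl , end⊨ψ , ⊨φ) =
    suc (suc ℓ) , b ◃ (b ◃ π) , ◃◃-IsPMPath (Adjacent-sym a~b) pm , refl , end⊨ψ , ⊨φ′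
    where
    b⊨φ : _⊨_ F b φ
    b⊨φ = ⊨-step φ a~b same (⊨φ 0 (s≤s z≤n))
    ⊨φ′ : ∀ i → i < suc (suc ℓ) → _⊨_ F ((b ◃ (b ◃ π)) i) φ
    ⊨φ′ zero          _               = b⊨φ
    ⊨φ′ (suc zero)    _               = b⊨φ
    ⊨φ′ (suc (suc i)) (s≤s (s≤s i<ℓ)) = ⊨φ i i<ℓ

  Adjacent⇒≡η : ∀ {a b} → Adjacent a b → SameLabel F a b → _≡η_ F a b
  Adjacent⇒≡η a~b same φ =
    ⊨-step φ a~b same , ⊨-step φ (Adjacent-sym a~b) (SameLabel-sym same)

  IsUPath⇒≡η : ∀ {ℓ π} → IsUPath F ℓ π → (∀ i → i < ℓ → SameLabel F (π i) (π (suc i))) →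
               ∀ i → i ≤ ℓ → _≡η_ F (π 0) (π i)
  IsUPath⇒≡η path same zero    _     = ≡η-refl
  IsUPath⇒≡η path same (suc i) i<ℓ =
    ≡η-trans (IsUPath⇒≡η path same i (<⇒≤ i<ℓ)) (Adjacent⇒≡η (path i i<ℓ) (same i i<ℓ))

lemma5p5 : {PL : Set} (F : PosetModel PL) (w₁ w₂ : World F) →
           _⇌_ F w₁ w₂ → _≡η_ F w₁ w₂
lemma5p5 F w₁ w₂ (ℓ , π , path , refl , refl , same) =
  IsUPath⇒≡η F path (λ i i<ℓ → same i (suc i) (<⇒≤ i<ℓ) i<ℓ) ℓ ≤-refl
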